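{- Let $\alpha$ be a unit interval parking function of length $n$ and let $b_1\,|\,b_2\,|\,\cdots\,|\,b_m$ be its block structure. Then $\alpha$ is a unit Fubini ranking if and only if $|b_j|\le 2$ for every $j\in[m]$.
   Context: $[n]=\{1,\ldots,n\}$. Parking process: $\alpha=(a_1,\ldots,a_n)\in[n]^n$ encodes preferences of cars $1,\ldots,n$ arriving in order at a one-way street with spots $1,\ldots,n$; car $i$ parks in spot $a_i$ if free, otherwise in the first free spot after $a_i$, if any. $\alpha$ is a parking function if all cars park (equivalently, its weakly increasing rearrangement $\alpha'=(a'_1,\ldots,a'_n)$ satisfies $a'_i\le i$ for all $i$). A unit interval parking function is a parking function in which each car $i$ parks in spot $a_i$ or $a_i+1$. A Fubini ranking is a tuple $(r_1,\ldots,r_n)\in[n]^n$ with $r_i=1+|\{j:r_j<r_i\}|$ for all $i$ (a ranking of competitors with ties, where $m$ competitors tied at rank $r$ make ranks $r+1,\ldots,r+m-1$ unused). A unit Fubini ranking is a tuple that is both a Fubini ranking and a unit interval parking function. Block structure: for a unit interval parking function $\alpha$ with weakly increasing rearrangement $\alpha'$, let $i_1<i_2<\cdots<i_m$ be all indices with $a'_{i_j}=i_j$, and set $i_{m+1}=n+1$; the blocks are $b_j=(a'_{i_j},a'_{i_j+1},\ldots,a'_{i_{j+1}-1})$, and $\alpha'$ is their concatenation $b_1|b_2|\cdots|b_m$. -}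

module Defs where

open import Data.Nat using (ℕ; zero; suc; _≤_; _<_; _∸_; _+_)
open import Data.Nat.Properties using (≤-decTotalOrder; _≟_; _<?_)
open import Data.List using (List; []; _∷_; _++_; _∷ʳ_; length; filter)
open import Data.List.Membership.DecPropositional _≟_ using (_∈?_)
open import Data.List.Relation.Unary.All using (All)
open import Data.List.Relation.Binary.Pointwise using (Pointwise)
open import Data.Maybe using (Maybe; just; nothing)
open import Data.Product using (∃; _×_)
open import Data.Sum using (_⊎_)
open import Relation.Binary.PropositionalEquality using (_≡_)
open import Relation.Nullary using (does)
open import Data.Bool using (if_then_else_; true; false)
import Data.List.Sort

open Data.List.Sort ≤-decTotalOrder using (sort)

-- Preference lists α = (a₁,…,aₙ) are represented as lists of naturals;
-- the street has spots 1,…,n where n is the length of the list.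

InRange : ℕ → List ℕ → Set
InRange n α = All (λ a → 1 ≤ a × a ≤ n) α

firstFree : ℕ → ℕ → List ℕ → Maybe ℕ
firstFree zero    s occ = nothing
firstFree (suc k) s occ = if does (s ∈? occ) then firstFree k (suc s) occ else just s

parkGo : ℕ → List ℕ → List ℕ → Maybe (List ℕ)
parkGo n occ []       = just []
parkGo n occ (a ∷ as) with firstFree (suc n ∸ a) a occ
... | nothing = nothing
... | just s with parkGo n (s ∷ occ) as
...   | nothing = nothing
...   | just ss = just (s ∷ ss)

outcome : List ℕ → Maybe (List ℕ)
outcome α = parkGo (length α) [] α

IsParkingFunction : List ℕ → Set
IsParkingFunction α = InRange (length α) α × ∃ λ spots → outcome α ≡ just spots

IsUnitIntervalPF : List ℕ → Set
IsUnitIntervalPF α =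
  InRange (length α) α ×
  ∃ λ spots → outcome α ≡ just spots ×
    Pointwise (λ a s → s ≡ a ⊎ s ≡ suc a) α spots

countBelow : ℕ → List ℕ → ℕ
countBelow x r = length (filter (_<? x) r)

IsFubiniRanking : List ℕ → Set
IsFubiniRanking r = InRange (length r) r × All (λ x → x ≡ suc (countBelow x r)) r

IsUnitFubini : List ℕ → Set
IsUnitFubini α = IsFubiniRanking α × IsUnitIntervalPF α

-- Block decomposition of a weakly increasing list α' = (a'₁,…,a'ₙ):
-- a new block starts at every index i with a'ᵢ = i and runs until the
-- next such index (or the end). Entries before the first such index
-- (there are none for a parking function) belong to no block.
-- `i` is the (1-based) index of the head of the remaining list;
-- `cur` is the block currently being built (nothing = no block started).
blocksGo : ℕ → Maybe (List ℕ) → List ℕ → List (List ℕ)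
blocksGo i nothing    []       = []
blocksGo i (just cur) []       = cur ∷ []
blocksGo i cur        (x ∷ xs) with does (x ≟ i)
blocksGo i nothing    (x ∷ xs) | true  = blocksGo (suc i) (just (x ∷ [])) xs
blocksGo i (just cur) (x ∷ xs) | true  = cur ∷ blocksGo (suc i) (just (x ∷ [])) xs
blocksGo i nothing    (x ∷ xs) | false = blocksGo (suc i) nothing xs
blocksGo i (just cur) (x ∷ xs) | false = blocksGo (suc i) (just (cur ∷ʳ x)) xs

blocks : List ℕ → List (List ℕ)
blocks α = blocksGo 1 nothing (sort α)

{-# OPTIONS --safe #-}
module Submission where

-- Let α' be the weakly increasing rearrangement of α. Every car parks in its preferred spot a or in
-- a + 1, and the spots are distinct, so a pigeonhole count gives k − 1 ≤ #{i : aᵢ < k} ≤ k; for a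
-- sorted list this says a'ⱼ ∈ {j − 1, j}. Thus α' is a staircase of hits a'ⱼ = j, each opening a
-- block, followed by lags a'ⱼ = j − 1. The Fubini condition a = 1 + #{i : aᵢ < a} holds at every
-- hit, and at a lag exactly when the preceding entry is a hit. Hence α is a Fubini ranking iff no
-- block contains two lags, i.e. iff every block is (j) or (j, j).

open import Defs
open import Data.Nat using (ℕ; suc; _≤_; _<_; _∸_; _+_; z≤n; s≤s; z<s; _≤?_; _<?_)
open import Data.Nat.Properties
open import Data.List using (List; []; _∷_; _∷ʳ_; length; filter)
open import Data.List.Properties using (filter-accept; filter-reject; filter-none; length-++)
open import Data.List.Relation.Unary.All as All using (All; []; _∷_)
open import Data.List.Relation.Unary.All.Properties using (all-filter; filter⁺)
open import Data.List.Relation.Unary.AllPairs as AllPairs using (AllPairs; []; _∷_)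
open import Data.List.Relation.Unary.Unique.Propositional using (Unique)
import Data.List.Relation.Unary.Unique.Propositional.Properties as Unique
open import Data.List.Relation.Unary.Any using (here; there)
open import Data.List.Relation.Unary.Sorted.TotalOrder.Properties using (Sorted⇒AllPairs)
open import Data.List.Relation.Binary.Pointwise using (Pointwise; []; _∷_; All-resp-Pointwise)
open import Data.List.Relation.Binary.Permutation.Propositional using (_↭_; ↭-sym; ↭⇒↭ₛ)
open import Data.List.Relation.Binary.Permutation.Propositional.Properties
  using (All-resp-↭; ↭-length; filter-↭)
import Data.List.Relation.Binary.Permutation.Setoid.Properties as PermutationSetoid
open import Data.List.Membership.Propositional using (_∉_)
open import Data.List.Membership.DecPropositional _≟_ using (_∈?_)
open import Data.List.Sort ≤-decTotalOrder using (sort; sort-↗; sort-↭)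
open import Data.Bool using (true; false)
open import Data.Maybe using (just; nothing)
open import Data.Product using (_×_; _,_; proj₁; proj₂)
open import Data.Sum as Sum using (_⊎_; inj₁; inj₂)
open import Data.Empty using (⊥-elim)
open import Function using (_∘_; _⟨_⟩_)
open import Level using (0ℓ)
open import Function.Bundles using (_⇔_; mk⇔; Equivalence)
import Function.Properties.Equivalence as ⇔
open import Relation.Binary.Bundles using (DecTotalOrder)
open import Relation.Binary.PropositionalEquality
open import Relation.Nullary using (¬_; yes; no; does)
open import Relation.Nullary.Decidable using (dec-true; dec-false)
open import Relation.Unary using (Pred; Decidable)
open import Relation.Unary.Properties using (∁?)

strictlyIncreasing⇒length≤ : ∀ {lo hi xs} → AllPairs _<_ xs → All (λ z → lo ≤ z × z < hi) xs →
                             length xs ≤ hi ∸ lo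
strictlyIncreasing⇒length≤ [] [] = z≤n
strictlyIncreasing⇒length≤ {lo} {hi} {x ∷ xs} (x<xs ∷ increasing) ((lo≤x , x<hi) ∷ bounds) = begin
  suc (length xs)   ≤⟨ s≤s (strictlyIncreasing⇒length≤ increasing
                          (All.zipWith (λ (x<y , (_ , y<hi)) → x<y , y<hi) (x<xs , bounds))) ⟩
  suc (hi ∸ suc x)  ≡⟨ +-∸-assoc 1 x<hi ⟨
  hi ∸ x            ≤⟨ ∸-monoʳ-≤ hi lo≤x ⟩
  hi ∸ lo           ∎
  where open ≤-Reasoning

unique⇒length≤ : ∀ {lo hi xs} → Unique xs → All (λ z → lo ≤ z × z < hi) xs → length xs ≤ hi ∸ lo
unique⇒length≤ {xs = xs} distinct bounds = subst (_≤ _) (↭-length (sort-↭ xs))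
  (strictlyIncreasing⇒length≤
    (AllPairs.zipWith (λ (x≤y , x≢y) → ≤∧≢⇒< x≤y x≢y) (sorted , sortedDistinct))
    (All-resp-↭ (↭-sym (sort-↭ xs)) bounds))
  where
  sorted : AllPairs _≤_ (sort xs)
  sorted = Sorted⇒AllPairs (DecTotalOrder.totalOrder ≤-decTotalOrder) (sort-↗ xs)
  sortedDistinct : Unique (sort xs)
  sortedDistinct = PermutationSetoid.Unique-resp-↭ (setoid ℕ) (↭⇒↭ₛ (↭-sym (sort-↭ xs))) distinct

firstFree-just : ∀ k s occ {t} → firstFree k s occ ≡ just t → t ∉ occ × t < s + k
firstFree-just (suc k) s occ {t} eq with s ∈? occ
... | yes _ = let t∉occ , t<1+s+k = firstFree-just k (suc s) occ eq
              in  t∉occ , subst (t <_) (sym (+-suc s k)) t<1+s+k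
firstFree-just (suc k) s occ refl | no s∉occ = s∉occ , m<m+n s z<s

parkGo-spots : ∀ n occ as {ss} → All (_≤ n) as → parkGo n occ as ≡ just ss →
               Unique ss × All (_∉ occ) ss × All (_≤ n) ss
parkGo-spots n occ [] _ refl = [] , [] , []
parkGo-spots n occ (a ∷ as) (a≤n ∷ as≤n) eq with firstFree (suc n ∸ a) a occ in free
... | just t with parkGo n (t ∷ occ) as in parked
...   | just ss with refl ← eq =
  let t∉occ , t<a+[1+n∸a] = firstFree-just (suc n ∸ a) a occ free
      distinct , new , ss≤n = parkGo-spots n (t ∷ occ) as as≤n parked
  in  All.map (λ t∉ t≡ → t∉ (here (sym t≡))) new ∷ distinct
    , t∉occ ∷ All.map (_∘ there) new
    , ≤-pred (subst (t <_) (m+[n∸m]≡n (m≤n⇒m≤1+n a≤n)) t<a+[1+n∸a]) ∷ ss≤n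

countBelow-accept : ∀ {k x} xs → x < k → countBelow k (x ∷ xs) ≡ suc (countBelow k xs)
countBelow-accept {k} xs x<k = cong length (filter-accept (_<? k) {xs = xs} x<k)

countBelow-reject : ∀ {k x} xs → k ≤ x → countBelow k (x ∷ xs) ≡ countBelow k xs
countBelow-reject {k} xs k≤x = cong length (filter-reject (_<? k) {xs = xs} (≤⇒≯ k≤x))

countBelow-∷-≤ : ∀ k x xs → countBelow k (x ∷ xs) ≤ suc (countBelow k xs)
countBelow-∷-≤ k x xs with x <? k
... | yes x<k = ≤-reflexive (countBelow-accept xs x<k)
... | no x≮k  = ≤-trans (≤-reflexive (countBelow-reject xs (≮⇒≥ x≮k))) (n≤1+n _)

countBelow-none : ∀ {k xs} → All (k ≤_) xs → countBelow k xs ≡ 0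
countBelow-none {k} k≤xs = cong length (filter-none (_<? k) (All.map ≤⇒≯ k≤xs))

countBelow-↭ : ∀ k {xs ys} → xs ↭ ys → countBelow k xs ≡ countBelow k ys
countBelow-↭ k xs↭ys = ↭-length (filter-↭ (_<? k) xs↭ys)

module _ {P : Pred ℕ 0ℓ} (P? : Decidable P) where

  length-filter-+-∁ : ∀ xs → length (filter P? xs) + length (filter (∁? P?) xs) ≡ length xs
  length-filter-+-∁ [] = refl
  length-filter-+-∁ (x ∷ xs) with P? x
  ... | yes _ = cong suc (length-filter-+-∁ xs)
  ... | no _  = trans (+-suc _ _) (cong suc (length-filter-+-∁ xs))

  length-filter-mono : ∀ {R : ℕ → ℕ → Set} {Q : Pred ℕ 0ℓ} (Q? : Decidable Q) →
                       (∀ {a b} → R a b → P a → Q b) →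
                       ∀ {xs ys} → Pointwise R xs ys → length (filter P? xs) ≤ length (filter Q? ys)
  length-filter-mono Q? P⇒Q [] = z≤n
  length-filter-mono Q? P⇒Q (_∷_ {x} {y} r rs) with P? x | Q? y
  ... | yes _  | yes _  = s≤s (length-filter-mono Q? P⇒Q rs)
  ... | yes px | no ¬qy = ⊥-elim (¬qy (P⇒Q r px))
  ... | no _   | yes _  = m≤n⇒m≤1+n (length-filter-mono Q? P⇒Q rs)
  ... | no _   | no _   = length-filter-mono Q? P⇒Q rs

module UnitIntervalCounts {α : List ℕ} (unitInterval : IsUnitIntervalPF α) where

  private
    n : ℕ
    n = length α

    spots : List ℕ
    spots = proj₁ (proj₂ unitInterval)

    nextToPreference : Pointwise (λ a s → s ≡ a ⊎ s ≡ suc a) α spots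
    nextToPreference = proj₂ (proj₂ (proj₂ unitInterval))

    spotsFacts : Unique spots × All (_∉ []) spots × All (_≤ n) spots
    spotsFacts = parkGo-spots n [] α (All.map proj₂ (proj₁ unitInterval))
                   (proj₁ (proj₂ (proj₂ unitInterval)))

    distinct : Unique spots
    distinct = proj₁ spotsFacts

    spots≤n : All (_≤ n) spots
    spots≤n = proj₂ (proj₂ spotsFacts)

    positive : All (1 ≤_) spots
    positive = All-resp-Pointwise (λ { (inj₁ refl) 1≤a → 1≤a ; (inj₂ refl) _ → s≤s z≤n })
                 nextToPreference (All.map proj₁ (proj₁ unitInterval))

  countBelow-≤ : ∀ k → countBelow k α ≤ k
  countBelow-≤ k = begin
    countBelow k α                 ≤⟨ length-filter-mono (_<? k) (_≤? k) nearby nextToPreference ⟩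
    length (filter (_≤? k) spots)  ≤⟨ unique⇒length≤ (Unique.filter⁺ (_≤? k) distinct)
                                        (All.zipWith (λ (1≤s , s≤k) → 1≤s , s≤s s≤k)
                                          (filter⁺ (_≤? k) positive , all-filter (_≤? k) spots)) ⟩
    k                              ∎
    where
    open ≤-Reasoning
    nearby : ∀ {a s} → s ≡ a ⊎ s ≡ suc a → a < k → s ≤ k
    nearby (inj₁ refl) a<k = <⇒≤ a<k
    nearby (inj₂ refl) a<k = a<k

  ≤-countBelow : ∀ k → k ≤ n → k ≤ countBelow (suc k) α
  ≤-countBelow k k≤n = begin
    k                    ≡⟨ m∸[m∸n]≡n k≤n ⟨
    n ∸ (n ∸ k)          ≤⟨ ∸-monoʳ-≤ n late≤ ⟩
    n ∸ late             ≡⟨ cong (_∸ late) (length-filter-+-∁ (_<? suc k) α) ⟨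
    early + late ∸ late  ≡⟨ m+n∸n≡m early late ⟩
    early                ∎
    where
    open ≤-Reasoning
    early late : ℕ
    early = countBelow (suc k) α
    late = length (filter (∁? (_<? suc k)) α)
    nearby : ∀ {a s} → s ≡ a ⊎ s ≡ suc a → ¬ a < suc k → suc k ≤ s
    nearby (inj₁ refl) a≮1+k = ≮⇒≥ a≮1+k
    nearby (inj₂ refl) a≮1+k = m≤n⇒m≤1+n (≮⇒≥ a≮1+k)
    late≤ : late ≤ n ∸ k
    late≤ = begin
      late                               ≤⟨ length-filter-mono (∁? (_<? suc k)) (suc k ≤?_)
                                              nearby nextToPreference ⟩
      length (filter (suc k ≤?_) spots)  ≤⟨ unique⇒length≤ (Unique.filter⁺ (suc k ≤?_) distinct)
                                              (All.zipWith (λ (1+k≤s , s≤n) → 1+k≤s , s≤s s≤n)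
                                                (all-filter (suc k ≤?_) spots ,
                                                 filter⁺ (suc k ≤?_) spots≤n)) ⟩
      n ∸ k                              ∎

-- The entries of xs, at positions i, i + 1, …, each equal their position (a hit) or are one less
-- (a lag); a lag never sits at position 1.
data Stair : ℕ → List ℕ → Set where
  []  : ∀ {i} → Stair i []
  hit : ∀ {i xs} → Stair (suc i) xs → Stair i (i ∷ xs)
  lag : ∀ {i xs} → Stair (3 + i) xs → Stair (2 + i) (suc i ∷ xs)

Stair-≥ : ∀ {i xs} → Stair (suc i) xs → All (i ≤_) xs
Stair-≥ []          = []
Stair-≥ (hit stair) = n≤1+n _ ∷ All.map <⇒≤ (Stair-≥ stair)
Stair-≥ (lag stair) = ≤-refl ∷ All.map <⇒≤ (Stair-≥ stair)

-- The counts of W are those of xs plus m further entries, all of them ≤ t.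
record Suffix (W : List ℕ) (t m : ℕ) (xs : List ℕ) : Set where
  field
    count-≤ : ∀ k → countBelow k W ≤ countBelow k xs + m
    count-≡ : ∀ k → t < k → countBelow k W ≡ countBelow k xs + m

Suffix-whole : ∀ {W t} → Suffix W t 0 W
Suffix-whole = record
  { count-≤ = λ k → ≤-reflexive (sym (+-identityʳ _))
  ; count-≡ = λ k _ → sym (+-identityʳ _)
  }

Suffix-∷ : ∀ {W t t′ m x xs} → t ≤ t′ → x ≤ t′ → Suffix W t m (x ∷ xs) → Suffix W t′ (suc m) xs
Suffix-∷ {W} {m = m} {x} {xs} t≤t′ x≤t′ suffix = record
  { count-≤ = λ k → begin
      countBelow k W                ≤⟨ count-≤ k ⟩
      countBelow k (x ∷ xs) + m     ≤⟨ +-monoˡ-≤ m (countBelow-∷-≤ k x xs) ⟩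
      suc (countBelow k xs) + m     ≡⟨ +-suc _ m ⟨
      countBelow k xs + suc m       ∎
  ; count-≡ = λ k t′<k → begin-equality
      countBelow k W                ≡⟨ count-≡ k (≤-<-trans t≤t′ t′<k) ⟩
      countBelow k (x ∷ xs) + m     ≡⟨ cong (_+ m) (countBelow-accept xs (≤-<-trans x≤t′ t′<k)) ⟩
      suc (countBelow k xs) + m     ≡⟨ +-suc _ m ⟨
      countBelow k xs + suc m       ∎
  }
  where
  open Suffix suffix
  open ≤-Reasoning

module SortedStair (W : List ℕ) (≤-upper : ∀ k → countBelow k W ≤ k)
                   (≤-lower : ∀ k → k ≤ length W → k ≤ countBelow (suc k) W) where

  position : ∀ {t m x xs} → Suffix W t m (x ∷ xs) → t ≤ x → All (x ≤_) xs →
             m + length (x ∷ xs) ≡ length W → x ≡ suc m ⊎ x ≡ m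
  position {t} {m} {x} {xs} suffix t≤x x≤xs len =
    Sum.map (≤-antisym atMost) sym (m≤n⇒m<n∨m≡n atLeast)
    where
    open Suffix suffix
    open ≤-Reasoning
    1+m≤n : suc m ≤ length W
    1+m≤n = subst (suc m ≤_) len (subst (suc m ≤_) (sym (+-suc m _)) (s≤s (m≤m+n m _)))
    atMost : x ≤ suc m
    atMost = ≮⇒≥ λ 1+m<x → 1+n≰n (begin
      suc m                            ≤⟨ ≤-lower (suc m) 1+m≤n ⟩
      countBelow (2 + m) W             ≤⟨ count-≤ (2 + m) ⟩
      countBelow (2 + m) (x ∷ xs) + m  ≡⟨ cong (_+ m) (countBelow-none
                                                         (1+m<x ∷ All.map (≤-trans 1+m<x) x≤xs)) ⟩
      m                                ∎)
    atLeast : m ≤ x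
    atLeast = ≮⇒≥ λ x<m → 1+n≰n (begin
      suc m                            ≤⟨ s≤s (m≤n+m m _) ⟩
      suc (countBelow m xs) + m        ≡⟨ cong (_+ m) (countBelow-accept xs x<m) ⟨
      countBelow m (x ∷ xs) + m        ≡⟨ count-≡ m (≤-<-trans t≤x x<m) ⟨
      countBelow m W                   ≤⟨ ≤-upper m ⟩
      m                                ∎)

  stair : ∀ {t m} xs → Suffix W t m xs → All (t ≤_) xs → AllPairs _≤_ xs → All (1 ≤_) xs →
          m + length xs ≡ length W → Stair (suc m) xs
  stair [] _ _ _ _ _ = []
  stair (x ∷ xs) suffix (t≤x ∷ _) (x≤xs ∷ sorted) (1≤x ∷ positive) len
    with position suffix t≤x x≤xs len | 1≤x
       | stair xs (Suffix-∷ t≤x ≤-refl suffix) x≤xs sorted positive (trans (sym (+-suc _ _)) len)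
  ... | inj₁ refl | _       | rest = hit rest
  ... | inj₂ refl | s≤s z≤n | rest = lag rest

data ShortBlocks : ℕ → List ℕ → Set where
  []     : ∀ {i} → ShortBlocks i []
  block₁ : ∀ {i xs} → ShortBlocks (suc i) xs → ShortBlocks i (i ∷ xs)
  block₂ : ∀ {i xs} → ShortBlocks (2 + i) xs → ShortBlocks i (i ∷ i ∷ xs)

Ranked : List ℕ → ℕ → Set
Ranked W x = x ≡ suc (countBelow x W)

module RankedStair (W : List ℕ) where

  ranked : ∀ {m xs} → Suffix W m m xs → All (suc m ≤_) xs → Ranked W (suc m)
  ranked {m} {xs} suffix 1+m≤xs = cong suc (sym (begin
    countBelow (suc m) W          ≡⟨ Suffix.count-≡ suffix (suc m) ≤-refl ⟩
    countBelow (suc m) xs + m     ≡⟨ cong (_+ m) (countBelow-none 1+m≤xs) ⟩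
    m                             ∎))
    where open ≡-Reasoning

  unranked : ∀ {m x xs} → Suffix W m m (x ∷ xs) → x ≤ m → ¬ Ranked W (suc m)
  unranked {m} {x} {xs} suffix x≤m r = 1+n≰n (begin
    suc m                            ≤⟨ s≤s (m≤n+m m _) ⟩
    suc (countBelow (suc m) xs) + m  ≡⟨ cong (_+ m) (countBelow-accept xs (s≤s x≤m)) ⟨
    countBelow (suc m) (x ∷ xs) + m  ≡⟨ Suffix.count-≡ suffix (suc m) ≤-refl ⟨
    countBelow (suc m) W             ≡⟨ suc-injective r ⟨
    m                                ∎)
    where open ≤-Reasoning

  ranked⇔shortBlocks-afterHit : ∀ {m xs} → Stair (2 + m) xs → Suffix W m m (suc m ∷ xs) →
                                All (Ranked W) xs ⇔ ShortBlocks (suc m) (suc m ∷ xs)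
  ranked⇔shortBlocks-afterHit [] _ = mk⇔ (λ _ → block₁ []) (λ _ → [])
  ranked⇔shortBlocks-afterHit {m} (hit {xs = xs} stair) suffix =
    mk⇔ (λ { (_ ∷ rs) → block₁ (to rs) })
        (λ { (block₁ blocks) → ranked suffix′ (≤-refl ∷ Stair-≥ stair) ∷ from blocks })
    where
    suffix′ : Suffix W (suc m) (suc m) (2 + m ∷ xs)
    suffix′ = Suffix-∷ (n≤1+n _) ≤-refl suffix
    open Equivalence (ranked⇔shortBlocks-afterHit stair suffix′)
  ranked⇔shortBlocks-afterHit (lag []) suffix =
    mk⇔ (λ _ → block₂ []) (λ _ → ranked suffix (≤-refl ∷ Stair-≥ (lag [])) ∷ [])
  ranked⇔shortBlocks-afterHit {m} (lag (hit {xs = xs} stair)) suffix =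
    mk⇔ (λ { (_ ∷ _ ∷ rs) → block₂ (to rs) })
        (λ { (block₂ blocks) → ranked suffix (≤-refl ∷ Stair-≥ (lag (hit stair)))
                              ∷ ranked suffix″ (≤-refl ∷ Stair-≥ stair) ∷ from blocks })
    where
    suffix″ : Suffix W (2 + m) (2 + m) (3 + m ∷ xs)
    suffix″ = Suffix-∷ (n≤1+n _) (n≤1+n _) (Suffix-∷ (n≤1+n _) ≤-refl suffix)
    open Equivalence (ranked⇔shortBlocks-afterHit stair suffix″)
  ranked⇔shortBlocks-afterHit (lag (lag stair)) suffix =
    mk⇔ (λ { (_ ∷ r ∷ _) → ⊥-elim (unranked (Suffix-∷ (n≤1+n _) ≤-refl suffix) ≤-refl r) })
        (λ { (block₂ ()) })

Short : List ℕ → Set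
Short b = length b ≤ 2

blocksGo-hit : ∀ i b xs → blocksGo i (just b) (i ∷ xs) ≡ b ∷ blocksGo (suc i) (just (i ∷ [])) xs
blocksGo-hit i b xs rewrite dec-true (i ≟ i) refl = refl

blocksGo-lag : ∀ i b xs → blocksGo (suc i) (just b) (i ∷ xs) ≡ blocksGo (2 + i) (just (b ∷ʳ i)) xs
blocksGo-lag i b xs rewrite dec-false (i ≟ suc i) (1+n≢n ∘ sym) = refl

long-block : ∀ i b xs → 3 ≤ length b → ¬ All Short (blocksGo i (just b) xs)
long-block i b [] long (short ∷ _) = <⇒≱ long short
long-block i b (x ∷ xs) long shorts with does (x ≟ i)
long-block i b (x ∷ xs) long (short ∷ _) | true = <⇒≱ long short
... | false = long-block (suc i) (b ∷ʳ x) xs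
                (≤-trans long (≤-trans (m≤m+n _ 1) (≤-reflexive (sym (length-++ b))))) shorts

blocks⇔shortBlocks-afterHit : ∀ {m xs} → Stair (2 + m) xs →
                              All Short (blocksGo (2 + m) (just (suc m ∷ [])) xs) ⇔
                              ShortBlocks (suc m) (suc m ∷ xs)
blocks⇔shortBlocks-afterHit [] = mk⇔ (λ _ → block₁ []) (λ _ → s≤s z≤n ∷ [])
blocks⇔shortBlocks-afterHit {m} (hit {xs = xs} stair)
  rewrite blocksGo-hit (2 + m) (suc m ∷ []) xs =
  mk⇔ (λ { (_ ∷ shorts) → block₁ (to shorts) }) (λ { (block₁ blocks) → s≤s z≤n ∷ from blocks })
  where open Equivalence (blocks⇔shortBlocks-afterHit stair)
blocks⇔shortBlocks-afterHit {m} (lag [])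
  rewrite blocksGo-lag (suc m) (suc m ∷ []) [] =
  mk⇔ (λ _ → block₂ []) (λ _ → ≤-refl ∷ [])
blocks⇔shortBlocks-afterHit {m} (lag (hit {xs = xs} stair))
  rewrite blocksGo-lag (suc m) (suc m ∷ []) (3 + m ∷ xs)
        | blocksGo-hit (3 + m) (suc m ∷ suc m ∷ []) xs =
  mk⇔ (λ { (_ ∷ shorts) → block₂ (to shorts) }) (λ { (block₂ blocks) → ≤-refl ∷ from blocks })
  where open Equivalence (blocks⇔shortBlocks-afterHit stair)
blocks⇔shortBlocks-afterHit {m} (lag (lag {xs = xs} stair))
  rewrite blocksGo-lag (suc m) (suc m ∷ []) (2 + m ∷ xs)
        | blocksGo-lag (2 + m) (suc m ∷ suc m ∷ []) xs =
  mk⇔ (⊥-elim ∘ long-block (4 + m) (suc m ∷ suc m ∷ 2 + m ∷ []) xs ≤-refl) (λ { (block₂ ()) })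

ranked⇔shortBlocks : ∀ {W} → Stair 1 W → All (Ranked W) W ⇔ ShortBlocks 1 W
ranked⇔shortBlocks [] = mk⇔ (λ _ → []) (λ _ → [])
ranked⇔shortBlocks {W} (hit stair) =
  mk⇔ (λ { (_ ∷ rs) → to rs })
      (λ blocks → ranked Suffix-whole (≤-refl ∷ Stair-≥ stair) ∷ from blocks)
  where
  open RankedStair W
  open Equivalence (ranked⇔shortBlocks-afterHit stair Suffix-whole)

blocks⇔shortBlocks : ∀ {W} → Stair 1 W → All Short (blocksGo 1 nothing W) ⇔ ShortBlocks 1 W
blocks⇔shortBlocks []          = mk⇔ (λ _ → []) (λ _ → [])
blocks⇔shortBlocks (hit stair) = blocks⇔shortBlocks-afterHit stair

ranked-↭ : ∀ {xs ys} → xs ↭ ys → All (Ranked xs) xs ⇔ All (Ranked ys) ys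
ranked-↭ xs↭ys = mk⇔ (transport xs↭ys) (transport (↭-sym xs↭ys))
  where
  transport : ∀ {xs ys} → xs ↭ ys → All (Ranked xs) xs → All (Ranked ys) ys
  transport xs↭ys =
    All-resp-↭ xs↭ys ∘ All.map (λ {x} r → trans r (cong suc (countBelow-↭ x xs↭ys)))

sort-stair : ∀ {α} → IsUnitIntervalPF α → Stair 1 (sort α)
sort-stair {α} unitInterval =
  stair (sort α) Suffix-whole (All.universal (λ _ → z≤n) _)
    (Sorted⇒AllPairs (DecTotalOrder.totalOrder ≤-decTotalOrder) (sort-↗ α))
    (All-resp-↭ (↭-sym (sort-↭ α)) (All.map proj₁ (proj₁ unitInterval))) refl
  where
  open UnitIntervalCounts unitInterval
  open SortedStair (sort α)
         (λ k → subst (_≤ k) (sym (countBelow-↭ k (sort-↭ α))) (countBelow-≤ k))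
         (λ k k≤n → subst (k ≤_) (sym (countBelow-↭ (suc k) (sort-↭ α)))
                      (≤-countBelow k (subst (k ≤_) (↭-length (sort-↭ α)) k≤n)))

unitFubini⇔ranked : ∀ {α} → IsUnitIntervalPF α → IsUnitFubini α ⇔ All (Ranked α) α
unitFubini⇔ranked unitInterval =
  mk⇔ (λ ((_ , ranked) , _) → ranked) (λ ranked → (proj₁ unitInterval , ranked) , unitInterval)

theorem3p5 : (α : List ℕ) → IsUnitIntervalPF α →
    (IsUnitFubini α ⇔ All (λ b → length b ≤ 2) (blocks α))
theorem3p5 α unitInterval =
  unitFubini⇔ranked unitInterval
    ⟨ ⇔.trans ⟩ ranked-↭ (↭-sym (sort-↭ α))
    ⟨ ⇔.trans ⟩ ranked⇔shortBlocks stair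
    ⟨ ⇔.trans ⟩ ⇔.sym (blocks⇔shortBlocks stair)
  where
  stair : Stair 1 (sort α)
  stair = sort-stair unitInterval
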